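{- Let $n\ge1$ and $m\in\mathcal{M}(n)$ a Motzkin path. Let $\mathcal{B}(m)=\{p\in\mathcal{D}(n):\theta(p)=m\}$. Then \[ \sum_{p \in \mathcal{B}(m)} q^{\operatorname{area}(p)}t^{\operatorname{rk}(p)} = q^{\operatorname{area}(m)}t^{\operatorname{rk}(m)}(1+qt)^{n-1-2\operatorname{rk}(m)}.\]
   Context: $\mathcal{D}(n)$ is the set of Dyck paths of order $n$: lattice paths from $(0,0)$ to $(2n,0)$ with $n$ steps $(1,1)$ and $n$ steps $(1,-1)$ never going below the $x$-axis. $\operatorname{area}(p)$ is the number of points $(x,y)\in\mathbb{Z}^2$ with $x+y$ even and $y\ge0$ lying strictly below $p$. $\phi(p)$ is the set partition of $\{1,\dots,n\}$ in which $i,i'$ share a block iff for some $j$ both $(2i-1,2j-1)$ and $(2i'-1,2j-1)$ lie on $p$ and the part of $p$ between them never goes below $y=2j-1$; $\operatorname{rk}(p)=n-(\text{number of blocks of }\phi(p))$. A Motzkin path of order $n$ is a path from $(1,1)$ to $(2n-1,1)$ with steps $(2,2)$, $(2,-2)$, $(2,0)$ never going below $y=1$; $\mathcal{M}(n)$ is their set. For $p\in\mathcal{D}(n)$, if $(2i-1,h_i)$ ($1\le i\le n$) are the points of $p$ with odd $x$-coordinate, $\theta(p)\in\mathcal{M}(n)$ is the path through $(1,h_1),(3,h_2),\dots,(2n-1,h_n)$ joined by straight segments. For $m\in\mathcal{M}(n)$, $\rho(m)\in\mathcal{D}(n)$ is obtained by an up step from $(0,0)$ to $(1,1)$, then replacing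 each up step of $m$ by two up steps, each down step by two down steps, each horizontal step by a down step then an up step, and a final down step to $(2n,0)$; $\operatorname{area}(m)=\operatorname{area}(\rho(m))$ and $\operatorname{rk}(m)=\operatorname{rk}(\rho(m))$ (equal to the number of up steps of $m$). -}

module Defs where

open import Data.Bool using (Bool; true; false; _∧_; not; if_then_else_)
open import Data.Nat using (ℕ; zero; suc; _+_; _*_; _∸_; _≡ᵇ_; _≤ᵇ_; _<ᵇ_; ⌊_/2⌋; _%_)
open import Data.List using (List; []; _∷_; _++_; length; map; concatMap; upTo; filterᵇ; drop)
open import Data.Nat.ListAction using (sum)
open import Data.Bool.ListAction using (all; any)
open import Data.Product using (_×_)
open import Data.Empty using (⊥)
open import Data.Unit using (⊤)
open import Relation.Binary.PropositionalEquality using (_≡_)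

-- Dyck paths: a list of steps U = (1,1), D = (1,-1).

data Step : Set where
  U D : Step

validFrom : ℕ → List Step → Set
validFrom h       []      = h ≡ 0
validFrom h       (U ∷ s) = validFrom (suc h) s
validFrom zero    (D ∷ s) = ⊥
validFrom (suc h) (D ∷ s) = validFrom h s

IsDyck : ℕ → List Step → Set
IsDyck n p = (length p ≡ 2 * n) × validFrom 0 p

heightsFrom : ℕ → List Step → List ℕ
heightsFrom h []      = h ∷ []
heightsFrom h (U ∷ s) = h ∷ heightsFrom (suc h) s
heightsFrom h (D ∷ s) = h ∷ heightsFrom (h ∸ 1) s

heights : List Step → List ℕ
heights = heightsFrom 0

-- element at index x (default 0)
at : List ℕ → ℕ → ℕ
at []       _       = 0
at (y ∷ ys) zero    = y
at (y ∷ ys) (suc x) = at ys x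

-- range a..b inclusive (empty if b < a)
range : ℕ → ℕ → List ℕ
range a b = map (a +_) (upTo (suc b ∸ a))

even : ℕ → Bool
even k = k % 2 ≡ᵇ 0

-- number of y with 0 ≤ y < h and x + y even  (points strictly below (x,h))
countBelow : ℕ → ℕ → ℕ
countBelow x h = length (filterᵇ (λ y → even (x + y)) (upTo h))

area : List Step → ℕ
area p = sum (map (λ x → countBelow x (at (heights p) x)) (range 0 (length p)))

-- i, i' (1-based, i ≤ i') share a block of φ(p): the points (2i-1, y) and
-- (2i'-1, y) are on p at a common height y = 2j-1 (j ≥ 1) and the part of p
-- between them never goes below y.
related : List Step → ℕ → ℕ → Bool
related p i i' =
  let hs = heights p
      a  = 2 * i ∸ 1
      b  = 2 * i' ∸ 1
      y  = at hs a
  in (y ≡ᵇ at hs b) ∧ not (even y) ∧ all (λ x → y ≤ᵇ at hs x) (range a b)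

order : List Step → ℕ
order p = ⌊ length p /2⌋

-- number of blocks of φ(p): count the blocks via their least elements
-- (i is the least element of its block iff it shares no block with any i' < i)
numBlocks : List Step → ℕ
numBlocks p =
  length (filterᵇ (λ i → not (any (λ i' → related p i' i) (range 1 (i ∸ 1))))
                  (range 1 (order p)))

rk : List Step → ℕ
rk p = order p ∸ numBlocks p

-- Motzkin paths: steps MU = (2,2), MD = (2,-2), MH = (2,0).

data MStep : Set where
  MU MD MH : MStep

validM : ℕ → List MStep → Set
validM h []        = h ≡ 1
validM h (MU ∷ s)  = validM (suc (suc h)) s
validM h (MH ∷ s)  = validM h s
validM (suc (suc (suc h))) (MD ∷ s) = validM (suc h) s
validM _ (MD ∷ s)  = ⊥

-- m ∈ ℳ(n): from (1,1) to (2n-1,1), so n-1 steps (n ≥ 1)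
IsMotzkin : ℕ → List MStep → Set
IsMotzkin n m = (length m ≡ n ∸ 1) × validM 1 m

-- θ(p): the segment from (2i-1,h_i) to (2i+1,h_{i+1}) is determined by the
-- two steps of p between these points.
segment : Step → Step → MStep
segment U U = MU
segment D D = MD
segment U D = MH
segment D U = MH

pairs : List Step → List MStep
pairs (a ∷ b ∷ s) = segment a b ∷ pairs s
pairs _           = []

θ : List Step → List MStep
θ p = pairs (drop 1 p)

ρstep : MStep → List Step
ρstep MU = U ∷ U ∷ []
ρstep MD = D ∷ D ∷ []
ρstep MH = D ∷ U ∷ []

ρ : List MStep → List Step
ρ m = U ∷ concatMap ρstep m ++ D ∷ []

areaM : List MStep → ℕ
areaM m = area (ρ m)

rkM : List MStep → ℕ
rkM m = rk (ρ m)

module Submission where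

-- Write p = U b D.  Then θ p = m exactly when b is a sequence of step pairs realising the
-- steps of m: U U for an up step, D D for a down step, and either a valley D U or a peak U D
-- for a flat step.  Turning a valley into a peak raises one lattice point by two, so it adds 1
-- to the area.  For the rank, i is the least element of its block of φ(p) iff the step of p
-- ending at abscissa 2i - 1 goes up: if it goes down, walking back to the previous visit of
-- that (odd) height finds an earlier element of the block.  Hence rk p is n minus the number
-- of up steps starting at even abscissae, and again each peak adds 1 compared with the valley
-- lift ρ(m).  So every flat step contributes a factor 1 + qt, and since a Motzkin path has as
-- many up as down steps there are n - 1 - 2 rk(m) flat steps.

open import Defs
open import Level using (Level)
open import Algebra.Bundles using (CommutativeSemiring)
import Algebra.Definitions.RawSemiring as RS
import Algebra.Properties.CommutativeSemigroup as CommutativeSemigroupProperties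
open import Data.List using (List; []; _∷_; _++_; map; foldr)
open import Data.List.Properties using (foldr-map)
open import Data.List.Membership.Propositional using (_∈_)
open import Data.List.Membership.Propositional.Properties.WithK using (unique∧set⇒bag)
open import Data.List.Relation.Binary.BagAndSetEquality using (∼bag⇒↭)
open import Data.List.Relation.Binary.Permutation.Propositional using (_↭_; ↭⇒↭ₛ′)
open import Data.List.Relation.Binary.Permutation.Propositional.Properties using (map⁺)
import Data.List.Relation.Binary.Permutation.Setoid.Properties as Permutation
open import Data.List.Relation.Unary.Any using (here; there)
open import Data.List.Relation.Unary.Unique.Propositional using (Unique)
import Data.List.Relation.Unary.Unique.Propositional.Properties as Unique
open import Data.Nat using (ℕ; zero; suc; _≥_; _∸_)
import Data.Nat as ℕ
import Data.Nat.Properties as ℕ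
open import Data.Product using (_×_; _,_; proj₂)
open import Function.Base using (_∘_)
open import Function.Bundles using (_⇔_)
import Function.Properties.Equivalence as ⇔
open import Relation.Binary.PropositionalEquality using (_≡_)
import Relation.Binary.PropositionalEquality as ≡

module Paths where

  open import Data.Bool using (Bool; true; false; not; _∧_; T; if_then_else_)
  open import Data.Bool.Properties using (not-involutive; T-≡; T-not-≡; T-∧; ⇔→≡)
  open import Data.Bool.ListAction using (all; any)
  open import Data.Empty using (⊥)
  open import Data.List using (concatMap; length; applyUpTo; upTo; filterᵇ)
  open import Data.List.Properties
    using (map-upTo; map-applyUpTo; length-++; ++-cancelʳ; ∷-injectiveʳ)
  open import Data.List.Membership.Propositional using (find; lose)
  open import Data.List.Membership.Propositional.Properties
    using (∈-map⁺; ∈-map⁻; ∈-upTo⁺; ∈-upTo⁻; ∈-++⁺ˡ; ∈-++⁺ʳ; ∈-++⁻)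
  import Data.List.Relation.Unary.All as All
  open import Data.List.Relation.Unary.All.Properties using (all⁺; all⁻)
  open import Data.List.Relation.Unary.AllPairs using ([]; _∷_)
  open import Data.List.Relation.Unary.Any.Properties using (any⁺; any⁻)
  open import Data.Nat
  open import Data.Nat.DivMod using ([m+n]%n≡m%n; m*n%n≡0)
  open import Data.Nat.ListAction using (sum)
  open import Data.Nat.Properties
  open import Data.Nat.Tactic.RingSolver using (solve-∀)
  open import Data.Product using (proj₁; ∃-syntax)
  open import Data.Sum using (_⊎_; inj₁; inj₂)
  open import Function.Bundles using (Equivalence; mk⇔)
  open import Relation.Binary.PropositionalEquality
  open import Relation.Nullary using (¬_; contradiction)

  even-2+ : ∀ k → even (2 + k) ≡ even k
  even-2+ k = cong (_≡ᵇ 0) (trans (cong (_% 2) (+-comm 2 k)) ([m+n]%n≡m%n k 2))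

  even-suc : ∀ k → even (suc k) ≡ not (even k)
  even-suc zero          = refl
  even-suc (suc zero)    = refl
  even-suc (suc (suc k)) = begin
    even (3 + k)       ≡⟨ even-2+ (suc k) ⟩
    even (suc k)       ≡⟨ even-suc k ⟩
    not (even k)       ≡⟨ cong not (even-2+ k) ⟨
    not (even (2 + k)) ∎
    where open ≡-Reasoning

  even-2* : ∀ j → even (2 * j) ≡ true
  even-2* j = cong (_≡ᵇ 0) (trans (cong (_% 2) (*-comm 2 j)) (m*n%n≡0 j 2))

  odd⇒≡1+2* : ∀ z → even z ≡ false → ∃[ k ] z ≡ suc (2 * k)
  odd⇒≡1+2* zero          ()
  odd⇒≡1+2* (suc zero)    _ = 0 , refl
  odd⇒≡1+2* (suc (suc z)) odd with k , refl ← odd⇒≡1+2* z (trans (sym (even-2+ z)) odd) =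
    suc k , cong suc (sym (*-suc 2 k))

  2*-suc∸1 : ∀ k → 2 * suc k ∸ 1 ≡ suc (2 * k)
  2*-suc∸1 k = cong (_∸ 1) (*-suc 2 k)

  2+-cong-2* : ∀ {l k} → l ≡ 2 * k → 2 + l ≡ 2 * suc k
  2+-cong-2* {k = k} l≡2k = trans (cong (2 +_) l≡2k) (sym (*-suc 2 k))

  T-⇔⇒≡ : ∀ {x y} → T x ⇔ T y → x ≡ y
  T-⇔⇒≡ x⇔y = ⇔→≡ (⇔.trans (⇔.sym T-≡) (⇔.trans x⇔y T-≡))

  ¬T⇒T-not : ∀ {x} → ¬ T x → T (not x)
  ¬T⇒T-not {false} _  = _
  ¬T⇒T-not {true}  ¬t = ¬t _

  T⇒¬T-not : ∀ {x} → T x → ¬ T (not x)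
  T⇒¬T-not {true} _ ()

  count : (ℕ → Bool) → ℕ → ℕ
  count g zero    = 0
  count g (suc n) = if g 0 then suc (count (g ∘ suc) n) else count (g ∘ suc) n

  length-filterᵇ-applyUpTo : ∀ {A : Set} (g : A → Bool) (f : ℕ → A) n →
                             length (filterᵇ g (applyUpTo f n)) ≡ count (g ∘ f) n
  length-filterᵇ-applyUpTo g f zero = refl
  length-filterᵇ-applyUpTo g f (suc n) with g (f 0)
  ... | true  = cong suc (length-filterᵇ-applyUpTo g (f ∘ suc) n)
  ... | false = length-filterᵇ-applyUpTo g (f ∘ suc) n

  count-cong : ∀ {g h} n → (∀ {i} → i < n → g i ≡ h i) → count g n ≡ count h n
  count-cong zero    g≗h = refl
  count-cong {h = h} (suc n) g≗h rewrite g≗h z<s =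
    cong (λ c → if h 0 then suc c else c) (count-cong n (g≗h ∘ s<s))

  count-alternating : ∀ {g} → (∀ i → g (suc i) ≡ not (g i)) → ∀ n → count g (2 + n) ≡ suc (count g n)
  count-alternating {g} alt zero rewrite alt 0 with g 0
  ... | true  = refl
  ... | false = refl
  count-alternating {g} alt (suc n) with g 0
  ... | true  = cong suc (count-alternating (alt ∘ suc) n)
  ... | false = count-alternating (alt ∘ suc) n

  ∈-range⁺ : ∀ {a b x} → a ≤ x → x ≤ b → x ∈ range a b
  ∈-range⁺ {a} {b} {x} a≤x x≤b =
    subst (_∈ range a b) (m+[n∸m]≡n a≤x) (∈-map⁺ (a +_) (∈-upTo⁺ (∸-monoˡ-< (s≤s x≤b) a≤x)))

  ∈-range⁻ : ∀ {a b x} → x ∈ range a b → a ≤ x × x ≤ b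
  ∈-range⁻ {a} {b} x∈ with c , c∈ , refl ← ∈-map⁻ (a +_) x∈ = m≤m+n a c , a+c≤b
    where
    c<b+1-a = ∈-upTo⁻ c∈
    a≤b : a ≤ b
    a≤b = s≤s⁻¹ (m∸n≢0⇒n<m λ b+1-a≡0 → n≮0 (subst (c <_) b+1-a≡0 c<b+1-a))
    a+c≤b : a + c ≤ b
    a+c≤b = s≤s⁻¹ (subst (_≤ suc b) (trans (+-comm (suc c) a) (+-suc a c))
                                      (m≤o∸n⇒m+n≤o (suc c) (m≤n⇒m≤1+n a≤b) c<b+1-a))

  -- Blocks of φ along a ±1 walk

  -- With H = at (heights p), `related p i i′` is `linked H (2 * i ∸ 1) (2 * i′ ∸ 1)` and
  -- `numBlocks p` counts the i ∈ [1, order p] with `leastInBlock H i`.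

  linked : (ℕ → ℕ) → ℕ → ℕ → Bool
  linked H a b = (H a ≡ᵇ H b) ∧ not (even (H a)) ∧ all (λ x → H a ≤ᵇ H x) (range a b)

  leastInBlock : (ℕ → ℕ) → ℕ → Bool
  leastInBlock H i = not (any (λ i′ → linked H (2 * i′ ∸ 1) (2 * i ∸ 1)) (range 1 (i ∸ 1)))

  riseAt : (ℕ → ℕ) → ℕ → Bool
  riseAt H j = H (2 * j) <ᵇ H (suc (2 * j))

  module _ {H : ℕ → ℕ} {a b : ℕ} where

    linked⇒≤ : T (linked H a b) → ∀ {x} → a ≤ x → x ≤ b → H b ≤ H x
    linked⇒≤ l a≤x x≤b =
      let Ha≡ᵇHb , rest = Equivalence.to T-∧ l
          _ , above     = Equivalence.to T-∧ rest
      in subst (_≤ H _) (≡ᵇ⇒≡ (H a) (H b) Ha≡ᵇHb)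
           (≤ᵇ⇒≤ _ _ (All.lookup (all⁺ _ (range a b) above) (∈-range⁺ a≤x x≤b)))

    linked-intro : H a ≡ H b → even (H b) ≡ false → (∀ {x} → a ≤ x → x ≤ b → H b ≤ H x) →
                   T (linked H a b)
    linked-intro Ha≡Hb odd above = Equivalence.from T-∧
      ( ≡⇒≡ᵇ (H a) (H b) Ha≡Hb
      , Equivalence.from T-∧
          ( Equivalence.from T-not-≡ (trans (cong even Ha≡Hb) odd)
          , all⁻ _ (All.tabulate λ x∈ → let a≤x , x≤b = ∈-range⁻ x∈ in
                      ≤⇒≤ᵇ (subst (_≤ H _) (sym Ha≡Hb) (above a≤x x≤b)))))

  module Walk (H : ℕ → ℕ) (L : ℕ) (H-zero : H 0 ≡ 0)
              (step : ∀ {x} → x < L → H (suc x) ≡ suc (H x) ⊎ H x ≡ suc (H (suc x))) where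

    step-parity : ∀ {x} → x < L → even (H (suc x)) ≡ not (even (H x))
    step-parity {x} x<L with step x<L
    ... | inj₁ up   = trans (cong even up) (even-suc (H x))
    ... | inj₂ down = trans (sym (not-involutive (even (H (suc x)))))
                            (cong not (trans (sym (even-suc (H (suc x)))) (cong even (sym down))))

    even-H : ∀ {x} → x ≤ L → even (H x) ≡ even x
    even-H {zero}  _   = cong even H-zero
    even-H {suc x} x<L =
      trans (step-parity x<L) (trans (cong not (even-H (<⇒≤ x<L))) (sym (even-suc x)))

    step-≤ : ∀ {x} → x < L → H (suc x) ≤ suc (H x)
    step-≤ x<L with step x<L
    ... | inj₁ up   = ≤-reflexive up
    ... | inj₂ down = ≤-trans (n≤1+n _) (≤-trans (≤-reflexive (sym down)) (n≤1+n _))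

    extend-above : ∀ {y z z′} → y ≤ H (suc z) → (∀ {w} → z′ ≤ w → w ≤ z → y ≤ H w) →
                   ∀ {w} → z′ ≤ w → w ≤ suc z → y ≤ H w
    extend-above y≤Hz+1 above z′≤w w≤z+1 with m≤n⇒m<n∨m≡n w≤z+1
    ... | inj₁ w<z+1 = above z′≤w (s≤s⁻¹ w<z+1)
    ... | inj₂ refl  = y≤Hz+1

    last-visit : ∀ {y} z → z ≤ L → y < H z →
                 ∃[ z′ ] z′ < z × H z′ ≡ y × (∀ {w} → z′ ≤ w → w ≤ z → y ≤ H w)
    last-visit zero    _   y<H0 = contradiction (subst (_ <_) H-zero y<H0) n≮0
    last-visit (suc z) z<L y<Hz+1 with m≤n⇒m<n∨m≡n (s≤s⁻¹ (≤-trans y<Hz+1 (step-≤ z<L)))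
    ... | inj₂ refl = z , n<1+n z , refl ,
                      extend-above (<⇒≤ y<Hz+1) λ z≤w w≤z → ≤-reflexive (cong H (≤-antisym z≤w w≤z))
    ... | inj₁ y<Hz with z′ , z′<z , Hz′≡y , above ← last-visit z (<⇒≤ z<L) y<Hz =
      z′ , m<n⇒m<1+n z′<z , Hz′≡y , extend-above (<⇒≤ y<Hz+1) above

    module _ {j} (2j<L : 2 * j < L) where

      rise⇒least : H (2 * j) < H (suc (2 * j)) → T (leastInBlock H (suc j))
      rise⇒least rise rewrite 2*-suc∸1 j =
        ¬T⇒T-not λ t → let _ , i′∈ , linked-i′ = find (any⁻ _ _ t) in no-earlier i′∈ linked-i′
        where
        no-earlier : ∀ {i′} → i′ ∈ range 1 j → ¬ T (linked H (2 * i′ ∸ 1) (suc (2 * j)))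
        no-earlier {zero}  i′∈ _ with () ← proj₁ (∈-range⁻ i′∈)
        no-earlier {suc k} i′∈ l = <⇒≱ rise (linked⇒≤ {H} l′ 2k+1≤2j (n≤1+n _))
          where
          l′ = subst (λ a → T (linked H a (suc (2 * j)))) (2*-suc∸1 k) l
          2k+1≤2j : suc (2 * k) ≤ 2 * j
          2k+1≤2j = ≤-trans (n≤1+n _)
                      (subst (_≤ 2 * j) (*-suc 2 k) (*-monoʳ-≤ 2 (proj₂ (∈-range⁻ i′∈))))

      odd-height : even (H (suc (2 * j))) ≡ false
      odd-height = trans (even-H 2j<L) (trans (even-suc (2 * j)) (cong not (even-2* j)))

      -- The last visit z′ of the height y = H (2j + 1) before 2j is odd since y is, and it
      -- links ⌈z′/2⌉ < j + 1 to j + 1.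
      fall⇒¬least : H (2 * j) ≡ suc (H (suc (2 * j))) → ¬ T (leastInBlock H (suc j))
      fall⇒¬least fall rewrite 2*-suc∸1 j
        with z′ , z′<2j , Hz′≡y , above ← last-visit (2 * j) (<⇒≤ 2j<L) (≤-reflexive (sym fall))
        with k , refl ← odd⇒≡1+2* z′ (trans (sym (even-H (<⇒≤ (<-trans z′<2j 2j<L))))
                                            (trans (cong even Hz′≡y) odd-height)) =
        T⇒¬T-not (any⁺ _ (lose (∈-range⁺ (s≤s z≤n) k<j) linked-k))
        where
        k<j : k < j
        k<j = *-cancelˡ-< 2 k j (<-trans (n<1+n _) z′<2j)
        linked-k : T (linked H (2 * suc k ∸ 1) (suc (2 * j)))
        linked-k = subst (λ a → T (linked H a (suc (2 * j)))) (sym (2*-suc∸1 k))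
                     (linked-intro Hz′≡y odd-height (extend-above ≤-refl above))

      least⇔rise : T (leastInBlock H (suc j)) ⇔ H (2 * j) < H (suc (2 * j))
      least⇔rise = mk⇔ least⇒rise rise⇒least
        where
        least⇒rise : T (leastInBlock H (suc j)) → H (2 * j) < H (suc (2 * j))
        least⇒rise least with step 2j<L
        ... | inj₁ up   = ≤-reflexive (sym up)
        ... | inj₂ down = contradiction least (fall⇒¬least down)

      leastInBlock≡riseAt : leastInBlock H (suc j) ≡ riseAt H j
      leastInBlock≡riseAt = T-⇔⇒≡ (⇔.trans least⇔rise (mk⇔ <⇒<ᵇ (<ᵇ⇒< _ _)))

  -- Dyck paths: blocks and rank

  next : Step → ℕ → ℕ
  next U h = suc h
  next D h = h ∸ 1

  at-heightsFrom-zero : ∀ h s → at (heightsFrom h s) 0 ≡ h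
  at-heightsFrom-zero h []      = refl
  at-heightsFrom-zero h (U ∷ s) = refl
  at-heightsFrom-zero h (D ∷ s) = refl

  at-heightsFrom-suc : ∀ h a s x → at (heightsFrom h (a ∷ s)) (suc x) ≡ at (heightsFrom (next a h) s) x
  at-heightsFrom-suc h U s x = refl
  at-heightsFrom-suc h D s x = refl

  heightsFrom-step : ∀ {h s} → validFrom h s → ∀ {x} → x < length s →
                     let H = at (heightsFrom h s) in H (suc x) ≡ suc (H x) ⊎ H x ≡ suc (H (suc x))
  heightsFrom-step {h}     {U ∷ s} v {zero}  _   = inj₁ (at-heightsFrom-zero (suc h) s)
  heightsFrom-step {suc h} {D ∷ s} v {zero}  _   = inj₂ (cong suc (sym (at-heightsFrom-zero h s)))
  heightsFrom-step {h}     {U ∷ s} v {suc x} x<l = heightsFrom-step {s = s} v (s≤s⁻¹ x<l)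
  heightsFrom-step {suc h} {D ∷ s} v {suc x} x<l = heightsFrom-step {s = s} v (s≤s⁻¹ x<l)

  isUp : Step → ℕ
  isUp U = 1
  isUp D = 0

  evenUps : List Step → ℕ
  evenUps []          = 0
  evenUps (a ∷ [])    = isUp a
  evenUps (a ∷ _ ∷ s) = isUp a + evenUps s

  rise-indicator : ∀ h a n → (if h <ᵇ next a h then suc n else n) ≡ isUp a + n
  rise-indicator h U n rewrite Equivalence.to T-≡ (<⇒<ᵇ (n<1+n h)) = refl
  rise-indicator h D n
    rewrite Equivalence.to T-not-≡ (¬T⇒T-not λ t → <⇒≱ (<ᵇ⇒< h (h ∸ 1) t) (m∸n≤m h 1)) = refl

  count-riseAt≡evenUps : ∀ h s k → length s ≡ 2 * k →
                         count (riseAt (at (heightsFrom h s))) k ≡ evenUps s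
  count-riseAt≡evenUps h []          zero    _ = refl
  count-riseAt≡evenUps h (a ∷ [])    zero    ()
  count-riseAt≡evenUps h (a ∷ [])    (suc k) 1≡2+2k with () ← suc-injective (trans 1≡2+2k (*-suc 2 k))
  count-riseAt≡evenUps h (a ∷ c ∷ s) (suc k) 2+l≡2+2k = begin
    count (riseAt H) (suc k)             ≡⟨ cong₂ (λ u v → if u <ᵇ v then suc C else C) H0 H1 ⟩
    (if h <ᵇ next a h then suc C else C) ≡⟨ rise-indicator h a C ⟩
    isUp a + C                           ≡⟨ cong (isUp a +_) (count-cong k λ {j} _ → riseAt-shift j) ⟩
    isUp a + count (riseAt H′) k         ≡⟨ cong (isUp a +_) (count-riseAt≡evenUps _ s k l≡2k) ⟩
    isUp a + evenUps s                   ∎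
    where
    open ≡-Reasoning
    H  = at (heightsFrom h (a ∷ c ∷ s))
    H′ = at (heightsFrom (next c (next a h)) s)
    C  = count (riseAt H ∘ suc) k
    l≡2k = suc-injective (suc-injective (trans 2+l≡2+2k (*-suc 2 k)))
    H0 : H 0 ≡ h
    H0 = at-heightsFrom-zero h (a ∷ c ∷ s)
    H1 : H 1 ≡ next a h
    H1 = trans (at-heightsFrom-suc h a (c ∷ s) 0) (at-heightsFrom-zero (next a h) (c ∷ s))
    shift : ∀ x → H (2 + x) ≡ H′ x
    shift x = trans (at-heightsFrom-suc h a (c ∷ s) (suc x)) (at-heightsFrom-suc (next a h) c s x)
    riseAt-shift : ∀ j → riseAt H (suc j) ≡ riseAt H′ j
    riseAt-shift j rewrite *-suc 2 j = cong₂ _<ᵇ_ (shift (2 * j)) (shift (suc (2 * j)))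

  order-Dyck : ∀ {n p} → IsDyck n p → order p ≡ n
  order-Dyck {n} (len , _) =
    trans (cong ⌊_/2⌋ len) (trans (cong (λ m → ⌊ n + m /2⌋) (+-identityʳ n)) (sym (n≡⌊n+n/2⌋ n)))

  numBlocks-Dyck : ∀ {n p} → IsDyck n p → numBlocks p ≡ evenUps p
  numBlocks-Dyck {n} {p} dyck@(len , valid) = begin
    numBlocks p                      ≡⟨ cong (length ∘ least ∘ range 1) (order-Dyck {n} {p} dyck) ⟩
    length (least (range 1 n))       ≡⟨ cong (length ∘ least) (map-upTo (1 +_) n) ⟩
    length (least (applyUpTo suc n)) ≡⟨ length-filterᵇ-applyUpTo (leastInBlock H) suc n ⟩
    count (leastInBlock H ∘ suc) n   ≡⟨ count-cong n (λ {j} j<n → leastInBlock≡riseAt {j} (2j<L j<n)) ⟩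
    count (riseAt H) n               ≡⟨ count-riseAt≡evenUps 0 p n len ⟩
    evenUps p                        ∎
    where
    open ≡-Reasoning
    H = at (heights p)
    open Walk H (length p) (at-heightsFrom-zero 0 p) (heightsFrom-step {s = p} valid)
    least = filterᵇ (leastInBlock H)
    2j<L : ∀ {j} → j < n → 2 * j < length p
    2j<L {j} j<n = subst (2 * j <_) (sym len) (*-monoʳ-< 2 j<n)

  rk-Dyck : ∀ {n p} → IsDyck n p → rk p ≡ n ∸ evenUps p
  rk-Dyck {n} {p} dyck = cong₂ _∸_ (order-Dyck {n} {p} dyck) (numBlocks-Dyck {n} {p} dyck)

  -- The fibre of θ

  -- For a Motzkin path m, `Lift m b` holds iff `close b` is a Dyck path with θ (close b) ≡ m.
  data Lift : List MStep → List Step → Set where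
    []     : Lift [] []
    up     : ∀ {m b} → Lift m b → Lift (MU ∷ m) (U ∷ U ∷ b)
    down   : ∀ {m b} → Lift m b → Lift (MD ∷ m) (D ∷ D ∷ b)
    valley : ∀ {m b} → Lift m b → Lift (MH ∷ m) (D ∷ U ∷ b)
    peak   : ∀ {m b} → Lift m b → Lift (MH ∷ m) (U ∷ D ∷ b)

  close : List Step → List Step
  close b = U ∷ b ++ D ∷ []

  close-injective : ∀ {b b′} → close b ≡ close b′ → b ≡ b′
  close-injective eq = ++-cancelʳ (D ∷ []) _ _ (∷-injectiveʳ eq)

  valleyLift : ∀ m → Lift m (concatMap ρstep m)
  valleyLift []       = []
  valleyLift (MU ∷ m) = up (valleyLift m)
  valleyLift (MD ∷ m) = down (valleyLift m)
  valleyLift (MH ∷ m) = valley (valleyLift m)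

  lifts : List MStep → List (List Step)
  lifts []       = [] ∷ []
  lifts (MU ∷ m) = map (λ b → U ∷ U ∷ b) (lifts m)
  lifts (MD ∷ m) = map (λ b → D ∷ D ∷ b) (lifts m)
  lifts (MH ∷ m) = map (λ b → D ∷ U ∷ b) (lifts m) ++ map (λ b → U ∷ D ∷ b) (lifts m)

  ∈-lifts⁺ : ∀ {m b} → Lift m b → b ∈ lifts m
  ∈-lifts⁺ []                = here refl
  ∈-lifts⁺ (up l)            = ∈-map⁺ _ (∈-lifts⁺ l)
  ∈-lifts⁺ (down l)          = ∈-map⁺ _ (∈-lifts⁺ l)
  ∈-lifts⁺ (valley l)        = ∈-++⁺ˡ (∈-map⁺ _ (∈-lifts⁺ l))
  ∈-lifts⁺ {MH ∷ m} (peak l) = ∈-++⁺ʳ (map _ (lifts m)) (∈-map⁺ _ (∈-lifts⁺ l))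

  ∈-lifts⁻ : ∀ m {b} → b ∈ lifts m → Lift m b
  ∈-lifts⁻ [] (here refl) = []
  ∈-lifts⁻ (MU ∷ m) b∈ with b′ , b′∈ , refl ← ∈-map⁻ _ b∈ = up (∈-lifts⁻ m b′∈)
  ∈-lifts⁻ (MD ∷ m) b∈ with b′ , b′∈ , refl ← ∈-map⁻ _ b∈ = down (∈-lifts⁻ m b′∈)
  ∈-lifts⁻ (MH ∷ m) b∈ with ∈-++⁻ (map _ (lifts m)) b∈
  ... | inj₁ b∈₁ with b′ , b′∈ , refl ← ∈-map⁻ _ b∈₁ = valley (∈-lifts⁻ m b′∈)
  ... | inj₂ b∈₂ with b′ , b′∈ , refl ← ∈-map⁻ _ b∈₂ = peak (∈-lifts⁻ m b′∈)

  lifts-unique : ∀ m → Unique (lifts m)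
  lifts-unique []       = All.[] ∷ []
  lifts-unique (MU ∷ m) = Unique.map⁺ (∷-injectiveʳ ∘ ∷-injectiveʳ) (lifts-unique m)
  lifts-unique (MD ∷ m) = Unique.map⁺ (∷-injectiveʳ ∘ ∷-injectiveʳ) (lifts-unique m)
  lifts-unique (MH ∷ m) = Unique.++⁺ (Unique.map⁺ (∷-injectiveʳ ∘ ∷-injectiveʳ) (lifts-unique m))
                                     (Unique.map⁺ (∷-injectiveʳ ∘ ∷-injectiveʳ) (lifts-unique m))
                                     valley≢peak
    where
    valley≢peak : ∀ {v} → v ∈ map (λ b → D ∷ U ∷ b) (lifts m) × v ∈ map (λ b → U ∷ D ∷ b) (lifts m) → ⊥
    valley≢peak (v∈₁ , v∈₂) with _ , _ , refl ← ∈-map⁻ _ v∈₁ with _ , _ , () ← ∈-map⁻ _ v∈₂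

  Lift-length : ∀ {m b} → Lift m b → length b ≡ 2 * length m
  Lift-length []         = refl
  Lift-length (up l)     = 2+-cong-2* (Lift-length l)
  Lift-length (down l)   = 2+-cong-2* (Lift-length l)
  Lift-length (valley l) = 2+-cong-2* (Lift-length l)
  Lift-length (peak l)   = 2+-cong-2* (Lift-length l)

  Lift-valid : ∀ {m b h} → Lift m b → validM (suc h) m → validFrom (suc h) (b ++ D ∷ [])
  Lift-valid []                         v = suc-injective v
  Lift-valid (up l)                     v = Lift-valid l v
  Lift-valid {h = suc (suc h)} (down l) v = Lift-valid l v
  Lift-valid (valley l)                 v = Lift-valid l v
  Lift-valid (peak l)                   v = Lift-valid l v

  Lift-pairs : ∀ {m b} → Lift m b → pairs (b ++ D ∷ []) ≡ m
  Lift-pairs []         = refl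
  Lift-pairs (up l)     = cong (MU ∷_) (Lift-pairs l)
  Lift-pairs (down l)   = cong (MD ∷_) (Lift-pairs l)
  Lift-pairs (valley l) = cong (MH ∷_) (Lift-pairs l)
  Lift-pairs (peak l)   = cong (MH ∷_) (Lift-pairs l)

  Lift-∷ : ∀ a c {m b} → Lift m b → Lift (segment a c ∷ m) (a ∷ c ∷ b)
  Lift-∷ U U = up
  Lift-∷ D D = down
  Lift-∷ D U = valley
  Lift-∷ U D = peak

  validFrom-tail : ∀ {h} a c {r} → validFrom h (a ∷ c ∷ r) → validFrom (next c (next a h)) r
  validFrom-tail U U v = v
  validFrom-tail U D v = v
  validFrom-tail {suc h} D U v = v
  validFrom-tail {suc (suc h)} D D v = v

  validFrom⇒Lift : ∀ {h r k} → validFrom h r → length r ≡ suc (2 * k) →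
                   ∃[ b ] Lift (pairs r) b × r ≡ b ++ D ∷ []
  validFrom⇒Lift {r = D ∷ []} _ _ = [] , [] , refl
  validFrom⇒Lift {r = U ∷ []} ()
  validFrom⇒Lift {r = a ∷ c ∷ r} {zero} _ ()
  validFrom⇒Lift {r = a ∷ c ∷ r} {suc k} v len
    with b , l , refl ← validFrom⇒Lift {r = r} {k} (validFrom-tail a c v)
                          (suc-injective (suc-injective (trans len (cong suc (*-suc 2 k))))) =
    a ∷ c ∷ b , Lift-∷ a c l , refl

  fibre : List MStep → List (List Step)
  fibre m = map close (lifts m)

  fibre-unique : ∀ m → Unique (fibre m)
  fibre-unique m = Unique.map⁺ close-injective (lifts-unique m)

  ∈-fibre⇔ : ∀ {n m} → IsMotzkin (suc n) m → ∀ {p} → p ∈ fibre m ⇔ (IsDyck (suc n) p × θ p ≡ m)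
  ∈-fibre⇔ {n} {m} (length-m , valid-m) = mk⇔ to from
    where
    to : ∀ {p} → p ∈ fibre m → IsDyck (suc n) p × θ p ≡ m
    to p∈ with b , b∈ , refl ← ∈-map⁻ close p∈ = (length-close , Lift-valid l valid-m) , Lift-pairs l
      where
      l = ∈-lifts⁻ m b∈
      length-close : length (close b) ≡ 2 * suc n
      length-close = begin
        suc (length (b ++ D ∷ [])) ≡⟨ cong suc (length-++ b) ⟩
        suc (length b + 1)         ≡⟨ cong suc (+-comm (length b) 1) ⟩
        2 + length b               ≡⟨ 2+-cong-2* (trans (Lift-length l) (cong (2 *_) length-m)) ⟩
        2 * suc n                  ∎
        where open ≡-Reasoning
    from : ∀ {p} → IsDyck (suc n) p × θ p ≡ m → p ∈ fibre m
    from {U ∷ r} ((len , valid) , θp≡m)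
      with b , l , refl ← validFrom⇒Lift {r = r} {n} valid (suc-injective (trans len (*-suc 2 n))) =
      ∈-map⁺ close (∈-lifts⁺ (subst (λ m → Lift m b) θp≡m l))
    from {D ∷ _} ((_ , ()) , _)
    from {[]}    ((() , _) , _)

  -- Area

  countBelow-2+ : ∀ x y → countBelow x (2 + y) ≡ suc (countBelow x y)
  countBelow-2+ x y = begin
    countBelow x (2 + y)               ≡⟨ length-filterᵇ-applyUpTo P (λ z → z) (2 + y) ⟩
    count P (2 + y)                    ≡⟨ count-alternating alt y ⟩
    suc (count P y)                    ≡⟨ cong suc (length-filterᵇ-applyUpTo P (λ z → z) y) ⟨
    suc (countBelow x y)               ∎
    where
    open ≡-Reasoning
    P = λ z → even (x + z)
    alt : ∀ z → P (suc z) ≡ not (P z)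
    alt z = trans (cong even (+-suc x z)) (even-suc (x + z))

  sumAlong : (ℕ → ℕ → ℕ) → ℕ → List Step → ℕ
  sumAlong φ h []      = φ 0 h
  sumAlong φ h (a ∷ s) = φ 0 h + sumAlong (φ ∘ suc) (next a h) s

  sum-heightsFrom : ∀ φ h s →
    sum (applyUpTo (λ x → φ x (at (heightsFrom h s) x)) (suc (length s))) ≡ sumAlong φ h s
  sum-heightsFrom φ h []      = +-identityʳ (φ 0 h)
  sum-heightsFrom φ h (U ∷ s) = cong (φ 0 h +_) (sum-heightsFrom (φ ∘ suc) (suc h) s)
  sum-heightsFrom φ h (D ∷ s) = cong (φ 0 h +_) (sum-heightsFrom (φ ∘ suc) (h ∸ 1) s)

  area≡sumAlong : ∀ p → area p ≡ sumAlong countBelow 0 p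
  area≡sumAlong p = begin
    sum (map g (map (0 +_) (upTo L))) ≡⟨ cong (sum ∘ map g) (map-upTo (0 +_) L) ⟩
    sum (map g (applyUpTo (0 +_) L))  ≡⟨ cong sum (map-applyUpTo (0 +_) g L) ⟩
    sum (applyUpTo g L)               ≡⟨ sum-heightsFrom countBelow 0 p ⟩
    sumAlong countBelow 0 p           ∎
    where
    open ≡-Reasoning
    L = suc (length p)
    g = λ x → countBelow x (at (heights p) x)

  peaks : List Step → ℕ
  peaks (U ∷ D ∷ s) = suc (peaks s)
  peaks (_ ∷ _ ∷ s) = peaks s
  peaks _           = 0

  peaks-valleyLift : ∀ m → peaks (concatMap ρstep m) ≡ 0
  peaks-valleyLift []       = refl
  peaks-valleyLift (MU ∷ m) = peaks-valleyLift m
  peaks-valleyLift (MD ∷ m) = peaks-valleyLift m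
  peaks-valleyLift (MH ∷ m) = peaks-valleyLift m

  lift-step : ∀ a c {s s′ p} → s ≡ s′ + p → a + (c + s) ≡ a + (c + s′) + p
  lift-step a c {s′ = s′} {p} refl = regroup a c s′ p
    where
    regroup : ∀ a c s p → a + (c + (s + p)) ≡ a + (c + s) + p
    regroup = solve-∀

  lift-step-peak : ∀ a {c c′ s s′ p} → c ≡ suc c′ → s ≡ s′ + p → a + (c + s) ≡ a + (c′ + s′) + suc p
  lift-step-peak a {c′ = c′} {s′ = s′} {p} refl refl = regroup a c′ s′ p
    where
    regroup : ∀ a c s p → a + (suc c + (s + p)) ≡ a + (c + s) + suc p
    regroup = solve-∀

  -- A lift and the valley lift only differ at the apexes of peaks, which sit two units
  -- higher than the corresponding valley points.
  sumAlong-Lift : ∀ {φ} → (∀ x y → φ x (2 + y) ≡ suc (φ x y)) →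
                  ∀ {m b h} → Lift m b → validM (suc h) m →
                  sumAlong φ (suc h) (b ++ D ∷ []) ≡
                  sumAlong φ (suc h) (concatMap ρstep m ++ D ∷ []) + peaks b
  sumAlong-Lift φ-2+ [] _ = sym (+-identityʳ _)
  sumAlong-Lift {φ} φ-2+ {h = h} (up l) v =
    lift-step (φ 0 (suc h)) (φ 1 (2 + h)) (sumAlong-Lift (φ-2+ ∘ (2 +_)) l v)
  sumAlong-Lift {φ} φ-2+ {h = suc (suc h)} (down l) v =
    lift-step (φ 0 (3 + h)) (φ 1 (2 + h)) (sumAlong-Lift (φ-2+ ∘ (2 +_)) l v)
  sumAlong-Lift {φ} φ-2+ {h = h} (valley l) v =
    lift-step (φ 0 (suc h)) (φ 1 h) (sumAlong-Lift (φ-2+ ∘ (2 +_)) l v)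
  sumAlong-Lift {φ} φ-2+ {h = h} (peak l) v =
    lift-step-peak (φ 0 (suc h)) (φ-2+ 1 h) (sumAlong-Lift (φ-2+ ∘ (2 +_)) l v)

  area-close : ∀ {m b} → Lift m b → validM 1 m → area (close b) ≡ areaM m + peaks b
  area-close {m} {b} l valid = begin
    area (close b)
      ≡⟨ area≡sumAlong (close b) ⟩
    0 + sumAlong (countBelow ∘ suc) 1 (b ++ D ∷ [])
      ≡⟨ sumAlong-Lift (countBelow-2+ ∘ suc) l valid ⟩
    sumAlong (countBelow ∘ suc) 1 (concatMap ρstep m ++ D ∷ []) + peaks b
      ≡⟨ cong (_+ peaks b) (area≡sumAlong (ρ m)) ⟨
    areaM m + peaks b
      ∎
    where open ≡-Reasoning

  -- Rank

  ups downs flats : List MStep → ℕ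
  ups []         = 0
  ups (MU ∷ m)   = suc (ups m)
  ups (_ ∷ m)    = ups m
  downs []       = 0
  downs (MD ∷ m) = suc (downs m)
  downs (_ ∷ m)  = downs m
  flats []       = 0
  flats (MH ∷ m) = suc (flats m)
  flats (_ ∷ m)  = flats m

  length-steps : ∀ m → length m ≡ ups m + downs m + flats m
  length-steps []       = refl
  length-steps (MU ∷ m) = cong suc (length-steps m)
  length-steps (MD ∷ m) =
    trans (cong suc (length-steps m)) (cong (_+ flats m) (sym (+-suc (ups m) (downs m))))
  length-steps (MH ∷ m) =
    trans (cong suc (length-steps m)) (sym (+-suc (ups m + downs m) (flats m)))

  height-balance : ∀ {h} m → validM h m → 2 * ups m + h ≡ 2 * downs m + 1
  height-balance []       v = v
  height-balance {h} (MU ∷ m) v = trans (shift (ups m) h) (height-balance m v)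
    where
    shift : ∀ u h → 2 * suc u + h ≡ 2 * u + (2 + h)
    shift = solve-∀
  height-balance {suc (suc (suc h))} (MD ∷ m) v =
    trans (shiftˡ (ups m) h) (trans (cong (2 +_) (height-balance m v)) (shiftʳ (downs m)))
    where
    shiftˡ : ∀ u h → 2 * u + (3 + h) ≡ 2 + (2 * u + suc h)
    shiftˡ = solve-∀
    shiftʳ : ∀ d → 2 + (2 * d + 1) ≡ 2 * suc d + 1
    shiftʳ = solve-∀
  height-balance (MH ∷ m) v = height-balance m v

  ups≡downs : ∀ {m} → validM 1 m → ups m ≡ downs m
  ups≡downs {m} v =
    *-cancelˡ-≡ (ups m) (downs m) 2 (+-cancelʳ-≡ 1 (2 * ups m) (2 * downs m) (height-balance m v))

  Motzkin-length : ∀ {n m} → IsMotzkin (suc n) m → n ≡ 2 * ups m + flats m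
  Motzkin-length {n} {m} (length-m , valid) = begin
    n                         ≡⟨ length-m ⟨
    length m                  ≡⟨ length-steps m ⟩
    ups m + downs m + flats m ≡⟨ cong (λ d → ups m + d + flats m) (ups≡downs {m} valid) ⟨
    ups m + ups m + flats m   ≡⟨ cong (λ u → ups m + u + flats m) (+-identityʳ (ups m)) ⟨
    2 * ups m + flats m       ∎
    where open ≡-Reasoning

  evenUps-Lift : ∀ x {m b} → Lift m b → evenUps (x ∷ b ++ D ∷ []) + peaks b ≡ isUp x + (ups m + flats m)
  evenUps-Lift U []         = refl
  evenUps-Lift D []         = refl
  evenUps-Lift x (up l)     = trans (+-assoc (isUp x) _ _) (cong (isUp x +_) (evenUps-Lift U l))
  evenUps-Lift x (down l)   = trans (+-assoc (isUp x) _ _) (cong (isUp x +_) (evenUps-Lift D l))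
  evenUps-Lift x {MH ∷ m} (valley l) =
    trans (+-assoc (isUp x) _ _)
          (cong (isUp x +_) (trans (evenUps-Lift U l) (sym (+-suc (ups m) (flats m)))))
  evenUps-Lift x {MH ∷ m} {U ∷ D ∷ b} (peak l) = trans (+-assoc (isUp x) _ _) (cong (isUp x +_) (begin
    evenUps (D ∷ b ++ D ∷ []) + suc (peaks b) ≡⟨ +-suc _ (peaks b) ⟩
    suc (evenUps (D ∷ b ++ D ∷ []) + peaks b) ≡⟨ cong suc (evenUps-Lift D l) ⟩
    suc (ups m + flats m)                     ≡⟨ +-suc (ups m) (flats m) ⟨
    ups m + suc (flats m)                     ∎))
    where open ≡-Reasoning

  rk-close : ∀ {n m b} → IsMotzkin (suc n) m → Lift m b → rk (close b) ≡ ups m + peaks b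
  rk-close {n} {m} {b} motzkin l = begin
    rk (close b)              ≡⟨ rk-Dyck {suc n} {close b} dyck ⟩
    suc n ∸ E                 ≡⟨ cong (_∸ E) 1+n≡ ⟩
    E + (ups m + peaks b) ∸ E ≡⟨ m+n∸m≡n E _ ⟩
    ups m + peaks b           ∎
    where
    open ≡-Reasoning
    E = evenUps (close b)
    dyck = proj₁ (Equivalence.to (∈-fibre⇔ {n} {m} motzkin) (∈-map⁺ close (∈-lifts⁺ l)))
    split : ∀ u f → suc (2 * u + f) ≡ suc (u + f) + u
    split = solve-∀
    regroup : ∀ e p u → e + p + u ≡ e + (u + p)
    regroup = solve-∀
    1+n≡ : suc n ≡ E + (ups m + peaks b)
    1+n≡ = begin
      suc n                         ≡⟨ cong suc (Motzkin-length {n} {m} motzkin) ⟩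
      suc (2 * ups m + flats m)     ≡⟨ split (ups m) (flats m) ⟩
      suc (ups m + flats m) + ups m ≡⟨ cong (_+ ups m) (evenUps-Lift U l) ⟨
      E + peaks b + ups m           ≡⟨ regroup E (peaks b) (ups m) ⟩
      E + (ups m + peaks b)         ∎

  rkM≡ups : ∀ {n m} → IsMotzkin (suc n) m → rkM m ≡ ups m
  rkM≡ups {n} {m} motzkin = begin
    rk (close (concatMap ρstep m))       ≡⟨ rk-close {n} {m} motzkin (valleyLift m) ⟩
    ups m + peaks (concatMap ρstep m)    ≡⟨ cong (ups m +_) (peaks-valleyLift m) ⟩
    ups m + 0                            ≡⟨ +-identityʳ (ups m) ⟩
    ups m                                ∎
    where open ≡-Reasoning

  flats≡ : ∀ {n m} → IsMotzkin (suc n) m → n ∸ 2 * ups m ≡ flats m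
  flats≡ {n} {m} motzkin =
    trans (cong (_∸ 2 * ups m) (Motzkin-length {n} {m} motzkin)) (m+n∸m≡n (2 * ups m) (flats m))

open Paths

module WeightedSums {c ℓ : Level} (R : CommutativeSemiring c ℓ) where

  open CommutativeSemiring R
  open RS rawSemiring using (_^_)
  open import Relation.Binary.Reasoning.Setoid setoid

  sumBy : ∀ {A : Set} → (A → Carrier) → List A → Carrier
  sumBy w = foldr (λ x acc → w x + acc) 0#

  sumBy-map : ∀ {A B : Set} (w : B → Carrier) (f : A → B) xs → sumBy w (map f xs) ≡ sumBy (w ∘ f) xs
  sumBy-map w f = foldr-map _ f 0#

  sumBy-++ : ∀ {A : Set} (w : A → Carrier) xs ys → sumBy w (xs ++ ys) ≈ sumBy w xs + sumBy w ys
  sumBy-++ w []       ys = sym (+-identityˡ _)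
  sumBy-++ w (x ∷ xs) ys = trans (+-congˡ (sumBy-++ w xs ys)) (sym (+-assoc _ _ _))

  sumBy-cong : ∀ {A : Set} {w w′ : A → Carrier} xs → (∀ {x} → x ∈ xs → w x ≈ w′ x) →
               sumBy w xs ≈ sumBy w′ xs
  sumBy-cong []       _    = refl
  sumBy-cong (x ∷ xs) w≈w′ = +-cong (w≈w′ (here ≡.refl)) (sumBy-cong xs (w≈w′ ∘ there))

  sumBy-↭ : ∀ {A : Set} (w : A → Carrier) {xs ys} → xs ↭ ys → sumBy w xs ≈ sumBy w ys
  sumBy-↭ w {xs} {ys} xs↭ys = begin
    sumBy w xs              ≡⟨ foldr-map _+_ w 0# xs ⟨
    foldr _+_ 0# (map w xs) ≈⟨ Permutation.foldr-commMonoid setoid +-isCommutativeMonoid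
                                 (↭⇒↭ₛ′ isEquivalence (map⁺ w xs↭ys)) ⟩
    foldr _+_ 0# (map w ys) ≡⟨ foldr-map _+_ w 0# ys ⟩
    sumBy w ys              ∎

  module _ (q t : Carrier) where

    open CommutativeSemigroupProperties *-commutativeSemigroup using (interchange)

    monomial : ℕ → ℕ → Carrier
    monomial i j = q ^ i * t ^ j

    peakWeight : ℕ → ℕ → List Step → Carrier
    peakWeight a r b = monomial (a ℕ.+ peaks b) (r ℕ.+ peaks b)

    peakWeight-peak : ∀ a r b → peakWeight a r (U ∷ D ∷ b) ≡ peakWeight (suc a) (suc r) b
    peakWeight-peak a r b = ≡.cong₂ monomial (ℕ.+-suc a (peaks b)) (ℕ.+-suc r (peaks b))

    sum-lifts : ∀ m a r → sumBy (peakWeight a r) (lifts m) ≈ q ^ a * t ^ r * (1# + q * t) ^ flats m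
    sum-lifts [] a r = begin
      monomial (a ℕ.+ 0) (r ℕ.+ 0) + 0# ≈⟨ +-identityʳ _ ⟩
      monomial (a ℕ.+ 0) (r ℕ.+ 0)      ≡⟨ ≡.cong₂ monomial (ℕ.+-identityʳ a) (ℕ.+-identityʳ r) ⟩
      monomial a r                      ≈⟨ *-identityʳ _ ⟨
      monomial a r * 1#                 ∎
    sum-lifts (MU ∷ m) a r = trans (reflexive (sumBy-map _ _ (lifts m))) (sum-lifts m a r)
    sum-lifts (MD ∷ m) a r = trans (reflexive (sumBy-map _ _ (lifts m))) (sum-lifts m a r)
    sum-lifts (MH ∷ m) a r = begin
      sumBy (peakWeight a r) (map (λ b → D ∷ U ∷ b) (lifts m) ++ map (λ b → U ∷ D ∷ b) (lifts m))
        ≈⟨ sumBy-++ _ (map _ (lifts m)) _ ⟩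
      sumBy (peakWeight a r) (map _ (lifts m)) + sumBy (peakWeight a r) (map _ (lifts m))
        ≡⟨ ≡.cong₂ _+_ (sumBy-map _ _ (lifts m)) (sumBy-map _ _ (lifts m)) ⟩
      sumBy (peakWeight a r) (lifts m) + sumBy (λ b → peakWeight a r (U ∷ D ∷ b)) (lifts m)
        ≈⟨ +-congˡ (sumBy-cong (lifts m) λ {b} _ → reflexive (peakWeight-peak a r b)) ⟩
      sumBy (peakWeight a r) (lifts m) + sumBy (peakWeight (suc a) (suc r)) (lifts m)
        ≈⟨ +-cong (sum-lifts m a r) (sum-lifts m (suc a) (suc r)) ⟩
      x * X + (q * q ^ a) * (t * t ^ r) * X
        ≈⟨ +-congˡ (trans (*-congʳ (trans (interchange q (q ^ a) t (t ^ r)) (*-comm _ _)))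
                          (*-assoc _ _ _)) ⟩
      x * X + x * (q * t * X)
        ≈⟨ distribˡ x X (q * t * X) ⟨
      x * (X + q * t * X)
        ≈⟨ *-congˡ (+-congʳ (*-identityˡ X)) ⟨
      x * (1# * X + q * t * X)
        ≈⟨ *-congˡ (distribʳ X 1# (q * t)) ⟨
      x * ((1# + q * t) * X)
        ∎
      where
      x = q ^ a * t ^ r
      X = (1# + q * t) ^ flats m

open WeightedSums

proposition2p7 : ∀ {c ℓ : Level} (n : ℕ) → n ≥ 1 → (m : List MStep) → IsMotzkin n m →
    (ps : List (List Step)) → Unique ps →
    (∀ p → (p ∈ ps) ⇔ (IsDyck n p × θ p ≡ m)) →
    (R : CommutativeSemiring c ℓ) → (q t : CommutativeSemiring.Carrier R) →
    let open CommutativeSemiring R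
        open RS rawSemiring using (_^_)
    in foldr (λ p acc → (q ^ area p) * (t ^ rk p) + acc) 0# ps
       ≈ (q ^ areaM m) * (t ^ rkM m) * ((1# + q * t) ^ (n ∸ 1 ∸ 2 ℕ.* rkM m))
proposition2p7 zero    ()
proposition2p7 (suc n) _ m motzkin ps ps-unique ps-fibre R q t = begin
  sumBy R w ps                                               ≈⟨ sumBy-↭ R w ps↭fibre ⟩
  sumBy R w (fibre m)                                        ≡⟨ sumBy-map R w close (lifts m) ⟩
  sumBy R (w ∘ close) (lifts m)                              ≈⟨ sumBy-cong R (lifts m) w-close ⟩
  sumBy R (peakWeight R q t (areaM m) (ups m)) (lifts m)     ≈⟨ sum-lifts R q t m (areaM m) (ups m) ⟩
  q ^ areaM m * t ^ ups m * (1# + q * t) ^ flats m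
    ≡⟨ ≡.cong₂ (λ i j → q ^ areaM m * t ^ i * (1# + q * t) ^ j) (≡.sym rkM≡ups′) exponent ⟩
  q ^ areaM m * t ^ rkM m * (1# + q * t) ^ (n ∸ 2 ℕ.* rkM m) ∎
  where
  open CommutativeSemiring R
  open RS rawSemiring using (_^_)
  open import Relation.Binary.Reasoning.Setoid setoid
  w : List Step → Carrier
  w p = monomial R q t (area p) (rk p)
  rkM≡ups′ : rkM m ≡ ups m
  rkM≡ups′ = rkM≡ups {n} {m} motzkin
  ps↭fibre : ps ↭ fibre m
  ps↭fibre = ∼bag⇒↭ (unique∧set⇒bag ps-unique (fibre-unique m)
                                    (⇔.trans (ps-fibre _) (⇔.sym (∈-fibre⇔ {n} {m} motzkin))))
  w-close : ∀ {b} → b ∈ lifts m → w (close b) ≈ peakWeight R q t (areaM m) (ups m) b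
  w-close b∈ = let l = ∈-lifts⁻ m b∈ in
    reflexive (≡.cong₂ (monomial R q t) (area-close l (proj₂ motzkin)) (rk-close {n} {m} motzkin l))
  exponent : flats m ≡ n ∸ 2 ℕ.* rkM m
  exponent = ≡.trans (≡.sym (flats≡ {n} {m} motzkin)) (≡.cong (λ r → n ∸ 2 ℕ.* r) (≡.sym rkM≡ups′))
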